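{- For $\sigma,\tau \in S_3$, say $\sigma$ and $\tau$ are ch-Wilf equivalent if $Ch_n(\{\sigma\};q)=Ch_n(\{\tau\};q)$ for all $n\ge 0$. Then the ch-Wilf equivalence classes of the six permutations of $S_3$ are exactly $\{123\}$, $\{321\}$, $\{312,132\}$ and $\{213,231\}$.
   Context: $S_n$ is the set of permutations of $[n]$ in one-line notation. A permutation $\pi$ avoids $\sigma$ if no subsequence of $\pi$ is order isomorphic to $\sigma$; for a set $\Pi$ of permutations, $Av_n(\Pi)$ is the set of permutations in $S_n$ avoiding every element of $\Pi$. For $\pi\in S_n$, the charge value of $i\in[n]$ is: $chv(1)=0$; for $i\ge2$, $chv(i)=0$ if $i$ is to the right of $i-1$ in $\pi$ and $chv(i)=n+1-i$ if $i$ is to the left of $i-1$ in $\pi$; the charge is $ch(\pi)=\sum_{i=1}^n chv(i)$. Define $Ch_n(\Pi;q)=\sum_{\sigma\in Av_n(\Pi)} q^{ch(\sigma)}$. -}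

module Defs where

open import Data.Nat using (ℕ; zero; suc; _∸_; _+_)
open import Data.Nat.ListAction using (sum)
import Data.Nat as ℕ
open import Data.Sum using (_⊎_)
open import Data.Fin using (Fin; toℕ; _<_; _<?_) renaming (zero to f0; suc to fs)
open import Data.Fin.Properties using (_≟_; all?; any?)
open import Data.Vec using (Vec; []; _∷_; lookup)
open import Data.List using (List; []; _∷_; concatMap; map; filter; length; allFin)
open import Data.Product using (Σ; ∃; _×_; _,_)
open import Relation.Binary.PropositionalEquality using (_≡_)
open import Relation.Nullary using (¬_; Dec; yes; no; ¬?)
open import Relation.Nullary.Decidable using (_×-dec_; _→-dec_)
open import Relation.Unary using (Decidable)

-- We encode [n] as Fin n (value v : Fin n
-- stands for the integer toℕ v + 1), and a word as a vector of length n.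
Word : ℕ → Set
Word n = Vec (Fin n) n

IsPerm : ∀ {n} → Word n → Set
IsPerm {n} π = ∀ (i j : Fin n) → lookup π i ≡ lookup π j → i ≡ j

isPerm? : ∀ {n} → Decidable (IsPerm {n})
isPerm? π = all? λ i → all? λ j → (lookup π i ≟ lookup π j) →-dec (i ≟ j)

words : ∀ {n} m → List (Vec (Fin n) m)
words zero    = [] ∷ []
words {n} (suc m) = concatMap (λ w → map (_∷ w) (allFin n)) (words m)

S : ∀ n → List (Word n)
S n = filter isPerm? (words n)

OrdIso : ∀ {n} → (Fin 3 → Fin n) → Vec (Fin 3) 3 → Set
OrdIso x σ = ∀ (a b : Fin 3) → (x a < x b → lookup σ a < lookup σ b)
                              × (lookup σ a < lookup σ b → x a < x b)

ordIso? : ∀ {n} (x : Fin 3 → Fin n) (σ : Vec (Fin 3) 3) → Dec (OrdIso x σ)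
ordIso? x σ = all? λ a → all? λ b →
  ((x a <? x b) →-dec (lookup σ a <? lookup σ b)) ×-dec
  ((lookup σ a <? lookup σ b) →-dec (x a <? x b))

Contains : ∀ {n} → Word n → Vec (Fin 3) 3 → Set
Contains {n} π σ = ∃ λ (i : Fin n) → ∃ λ (j : Fin n) → ∃ λ (k : Fin n) →
  i < j × j < k × OrdIso (lookup (lookup π i ∷ lookup π j ∷ lookup π k ∷ [])) σ

contains? : ∀ {n} (π : Word n) (σ : Vec (Fin 3) 3) → Dec (Contains π σ)
contains? π σ = any? λ i → any? λ j → any? λ k →
  (i <? j) ×-dec ((j <? k) ×-dec
    ordIso? (lookup (lookup π i ∷ lookup π j ∷ lookup π k ∷ [])) σ)

Avoids : ∀ {n} → Word n → Vec (Fin 3) 3 → Set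
Avoids π σ = ¬ Contains π σ

avoids? : ∀ {n} (π : Word n) (σ : Vec (Fin 3) 3) → Dec (Avoids π σ)
avoids? π σ = ¬? (contains? π σ)

Av : ∀ n → Vec (Fin 3) 3 → List (Word n)
Av n σ = filter (λ π → avoids? π σ) (S n)

LeftOf : ∀ {n} → Word n → Fin n → Fin n → Set
LeftOf {n} π u v = ∃ λ (p : Fin n) → ∃ λ (p' : Fin n) →
  p < p' × lookup π p ≡ u × lookup π p' ≡ v

leftOf? : ∀ {n} (π : Word n) (u v : Fin n) → Dec (LeftOf π u v)
leftOf? π u v = any? λ p → any? λ p' →
  (p <? p') ×-dec ((lookup π p ≟ u) ×-dec (lookup π p' ≟ v))

-- Charge value of the value v (representing i = toℕ v + 1):
-- chv(1) = 0; for i ≥ 2, chv(i) = n + 1 - i = n - toℕ v if i is to the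
-- left of i - 1, and 0 otherwise.
chv : ∀ {n} → Word n → Fin n → ℕ
chv {n} π v with toℕ v
... | zero  = 0
... | suc _ with any? (λ w → (suc (toℕ w) ℕ.≟ toℕ v) ×-dec leftOf? π v w)
...   | yes _ = n ∸ toℕ v
...   | no  _ = 0

ch : ∀ {n} → Word n → ℕ
ch {n} π = sum (map (chv π) (allFin n))

-- Ch_n({σ}; q) represented by its coefficient sequence:
-- ChCoeff n σ k = coefficient of q^k = #{π ∈ Av_n({σ}) : ch(π) = k}.
ChCoeff : ℕ → Vec (Fin 3) 3 → ℕ → ℕ
ChCoeff n σ k = length (filter (λ π → ch π ℕ.≟ k) (Av n σ))

-- ch-Wilf equivalence: Ch_n({σ};q) = Ch_n({τ};q) for all n ≥ 0
-- (equality of polynomials = equality of all coefficients).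
ChWilfEquiv : Vec (Fin 3) 3 → Vec (Fin 3) 3 → Set
ChWilfEquiv σ τ = ∀ (n k : ℕ) → ChCoeff n σ k ≡ ChCoeff n τ k

p123 p132 p213 p231 p312 p321 : Vec (Fin 3) 3
p123 = f0 ∷ fs f0 ∷ fs (fs f0) ∷ []
p132 = f0 ∷ fs (fs f0) ∷ fs f0 ∷ []
p213 = fs f0 ∷ f0 ∷ fs (fs f0) ∷ []
p231 = fs f0 ∷ fs (fs f0) ∷ f0 ∷ []
p312 = fs (fs f0) ∷ f0 ∷ fs f0 ∷ []
p321 = fs (fs f0) ∷ fs f0 ∷ f0 ∷ []

SameClass : Vec (Fin 3) 3 → Vec (Fin 3) 3 → Set
SameClass σ τ =
    (σ ≡ p123 × τ ≡ p123)
  ⊎ (σ ≡ p321 × τ ≡ p321)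
  ⊎ ((σ ≡ p312 ⊎ σ ≡ p132) × (τ ≡ p312 ⊎ τ ≡ p132))
  ⊎ ((σ ≡ p213 ⊎ σ ≡ p231) × (τ ≡ p213 ⊎ τ ≡ p231))

-- The charge of a permutation only records, for each i ≥ 2, whether i stands to the left of
-- i − 1. So two patterns are ch-Wilf equivalent as soon as there are injections between their
-- avoiders, in both directions, that preserve the relative position of all consecutive values.
-- After its first entry m, a 231-avoider lists all entries below m and then all entries above m;
-- recursively putting the block above m first yields a 213-avoider, and since two consecutive
-- values different from m lie in the same block, their relative position is unchanged. The
-- reverse of this map relates 312- and 132-avoiders. Conversely, already the coefficients of
-- Ch₃ distinguish the four classes, which is checked by computation.

module Submission where

open import Defs
open import Data.Bool using (Bool; true; false; not)
open import Data.Empty using (⊥; ⊥-elim)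
open import Data.Fin as Fin using (Fin; toℕ; fromℕ<) renaming (zero to f0; suc to fs)
open import Data.Fin.Properties
  using (any?; <-cmp; toℕ<n; toℕ-fromℕ<; fromℕ<-toℕ; toℕ-injective) renaming (_≟_ to _≟ᶠ_)
open import Data.List using (List; []; _∷_; _++_; [_]; length; filter; reverse; map; concatMap; allFin; upTo)
open import Data.List.Properties
  using (≡-dec; map-cong; length-filter; filter-++; filter-all; filter-none; length-++; length-reverse;
         reverse-involutive; ++-identityʳ)
open import Data.List.Membership.Propositional using (_∈_)
open import Data.List.Membership.Propositional.Properties
  using (∈-map⁺; ∈-map⁻; ∈-allFin; ∈-++⁺ˡ; ∈-++⁺ʳ; ∈-++⁻; ∈-filter⁺; ∈-filter⁻)
open import Data.List.Relation.Unary.All as All using (All; []; _∷_; all?)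
open import Data.List.Relation.Unary.All.Properties
  using (all-filter) renaming (++⁺ to All-++⁺; filter⁺ to All-filter⁺)
open import Data.List.Relation.Unary.AllPairs using ([]; _∷_)
open import Data.List.Relation.Unary.Any using (here; there)
open import Data.List.Relation.Unary.Unique.Propositional using (Unique)
import Data.List.Relation.Unary.Unique.Propositional.Properties as Unique
open import Data.List.Relation.Binary.Sublist.Propositional using (_⊆_; []; _∷_; _∷ʳ_; ⊆-refl; ⊆-trans; from∈)
open import Data.List.Relation.Binary.Sublist.Propositional.Properties
  using (++⁺ˡ; ++⁺ʳ; reverse⁺; reverse⁻; []⊆-universal; filter-⊆; filter⁺; All-resp-⊆; ∷ˡ⁻)
open import Data.List.Relation.Binary.Permutation.Propositional using (↭-sym)
open import Data.List.Relation.Binary.Permutation.Propositional.Properties using (All-resp-↭; ↭-reverse)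
open import Data.Nat using (ℕ; zero; suc; _+_; _<_; _≤_; _<?_; _≟_; z≤n; s≤s)
open import Data.Nat.ListAction using (sum)
open import Data.Nat.Properties
  using (≤-refl; ≤-reflexive; ≤-trans; ≤-antisym; <-irrefl; <-asym; <-trans; ≤-<-trans; ≤∧≢⇒<; ≮⇒≥;
         n<1+n; suc-injective; +-suc; +-comm)
open import Data.Product using (∃; ∃₂; _×_; _,_; proj₁; proj₂)
open import Data.Sum using (_⊎_; inj₁; inj₂)
open import Data.Vec as Vec using (Vec; []; _∷_; lookup; toList)
import Data.Vec.Properties as Vec
open import Function using (_∘_; _⇔_; mk⇔; Equivalence)
open import Level using (0ℓ)
open import Relation.Binary using (tri<; tri≈; tri>)
open import Relation.Binary.PropositionalEquality
  using (_≡_; _≢_; refl; sym; trans; cong; cong₂; subst; module ≡-Reasoning)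
open import Relation.Nullary using (¬_; Dec; yes; no)
open import Relation.Nullary.Decidable using (toWitness; _×-dec_; _⊎-dec_; _→-dec_)
open import Relation.Unary using (Pred; ∁; Decidable)
open import Relation.Unary.Properties using (∁?)

private
  variable
    f m x y : ℕ
    ws xs ys l r : List ℕ
    Q : Pred ℕ 0ℓ

-- Lists of distinct values and the patterns they avoid

lookup⊆ : All Q l → [ x ] ⊆ l → Q x
lookup⊆ a p with All-resp-⊆ p a
... | qx ∷ [] = qx

head⊆ : x ∷ ws ⊆ l → [ x ] ⊆ l
head⊆ p = ⊆-trans (refl ∷ []⊆-universal _) p

All-¬¬ : All Q l → All (∁ (∁ Q)) l
All-¬¬ = All.map (λ q ¬q → ¬q q)

All-reverse : All Q l → All Q (reverse l)
All-reverse {l = l} = All-resp-↭ (↭-sym (↭-reverse l))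

⊆-++-split : ∀ xs → ws ⊆ xs ++ ys → ∃₂ λ us vs → us ++ vs ≡ ws × us ⊆ xs × vs ⊆ ys
⊆-++-split [] p = [] , _ , refl , [] , p
⊆-++-split (x ∷ xs) (.x ∷ʳ p) with ⊆-++-split xs p
... | us , vs , e , q , q′ = us , vs , e , x ∷ʳ q , q′
⊆-++-split (x ∷ xs) (refl ∷ p) with ⊆-++-split xs p
... | us , vs , e , q , q′ = x ∷ us , vs , cong (x ∷_) e , refl ∷ q , q′

⊆-++⁻ˡ : All Q ws → All (∁ Q) ys → ws ⊆ xs ++ ys → ws ⊆ xs
⊆-++⁻ˡ {xs = []} [] _ _ = []
⊆-++⁻ˡ {xs = []} (qw ∷ _) a p with All-resp-⊆ p a
... | ¬qw ∷ _ = ⊥-elim (¬qw qw)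
⊆-++⁻ˡ {xs = x ∷ xs} a a′ (.x ∷ʳ p) = x ∷ʳ ⊆-++⁻ˡ a a′ p
⊆-++⁻ˡ {xs = x ∷ xs} (_ ∷ a) a′ (refl ∷ p) = refl ∷ ⊆-++⁻ˡ a a′ p

⊆-++⁻ʳ : All Q ws → All (∁ Q) xs → ws ⊆ xs ++ ys → ws ⊆ ys
⊆-++⁻ʳ {xs = []} _ _ p = p
⊆-++⁻ʳ {xs = x ∷ xs} a (_ ∷ a′) (.x ∷ʳ p) = ⊆-++⁻ʳ a a′ p
⊆-++⁻ʳ {xs = x ∷ xs} (qx ∷ _) (¬qx ∷ _) (refl ∷ p) = ⊥-elim (¬qx qx)

Distinct : List ℕ → Set
Distinct l = ∀ {x} → x ∷ x ∷ [] ⊆ l → ⊥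

Distinct-⊆ : xs ⊆ ys → Distinct ys → Distinct xs
Distinct-⊆ p d q = d (⊆-trans q p)

Distinct-tail : Distinct (x ∷ l) → Distinct l
Distinct-tail {x} d p = d (x ∷ʳ p)

Distinct-head : Distinct (x ∷ l) → All (_≢ x) l
Distinct-head {l = []} d = []
Distinct-head {x} {l = y ∷ l} d =
  (λ { refl → d (refl ∷ refl ∷ []⊆-universal l) }) ∷ Distinct-head (Distinct-⊆ (refl ∷ y ∷ʳ ⊆-refl) d)

Distinct-reverse : Distinct l → Distinct (reverse l)
Distinct-reverse {l} d {x} p = d (reverse⁻ {as = x ∷ x ∷ []} {bs = l} p)

Pattern : Set₁
Pattern = ℕ → ℕ → ℕ → Set

Free : Pattern → List ℕ → Set
Free P l = ∀ {a b c} → a ∷ b ∷ c ∷ [] ⊆ l → ¬ P a b c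

Free-⊆ : ∀ {P} → xs ⊆ ys → Free P ys → Free P xs
Free-⊆ p f q = f (⊆-trans q p)

Reversed : Pattern → Pattern
Reversed P a b c = P c b a

Free-reverse : ∀ {P} → Free P l → Free (Reversed P) (reverse l)
Free-reverse {l} f {a} {b} {c} p = f (reverse⁻ {as = c ∷ b ∷ a ∷ []} {bs = l} p)

Is231 Is213 Is312 Is132 : Pattern
Is231 a b c = c < a × a < b
Is213 a b c = b < a × a < c
Is312 a b c = b < c × c < a
Is132 a b c = a < c × c < b

Consecutive : ℕ → ℕ → Set
Consecutive x y = suc y ≡ x ⊎ suc x ≡ y

Consecutive-sym : Consecutive x y → Consecutive y x
Consecutive-sym (inj₁ e) = inj₂ e
Consecutive-sym (inj₂ e) = inj₁ e

≮∧≢⇒> : ¬ x < m → x ≢ m → m < x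
≮∧≢⇒> x≮m x≢m = ≤∧≢⇒< (≮⇒≥ x≮m) (x≢m ∘ sym)

Consecutive-no-gap : Consecutive x y → x < m → ¬ y < m → y ≢ m → ⊥
Consecutive-no-gap (inj₁ refl) x<m y≮m y≢m = <-asym x<m (<-trans (≮∧≢⇒> y≮m y≢m) (n<1+n _))
Consecutive-no-gap (inj₂ refl) x<m y≮m y≢m = <-irrefl refl (≤-<-trans x<m (≮∧≢⇒> y≮m y≢m))

Consecutive-same-side : Consecutive x y → x ≢ m → y ≢ m → (x < m × y < m) ⊎ (¬ x < m × ¬ y < m)
Consecutive-same-side {x} {y} {m} c x≢m y≢m with x <? m | y <? m
... | yes x<m | yes y<m = inj₁ (x<m , y<m)
... | no x≮m  | no y≮m  = inj₂ (x≮m , y≮m)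
... | yes x<m | no y≮m  = ⊥-elim (Consecutive-no-gap c x<m y≮m y≢m)
... | no x≮m  | yes y<m = ⊥-elim (Consecutive-no-gap (Consecutive-sym c) y<m x≮m x≢m)

below above : ℕ → List ℕ → List ℕ
below m = filter (_<? m)
above m = filter (∁? (_<? m))

⊆-filter : (Q? : Decidable Q) → All Q ws → ws ⊆ xs → ws ⊆ filter Q? xs
⊆-filter {xs = xs} Q? a p = subst (_⊆ filter Q? xs) (filter-all Q? a) (filter⁺ Q? Q? (λ { refl q → q }) p)

length-filter+filter∁ : (Q? : Decidable Q) → ∀ l →
  length (filter Q? l) + length (filter (∁? Q?) l) ≡ length l
length-filter+filter∁ Q? [] = refl
length-filter+filter∁ Q? (x ∷ l) with Q? x
... | yes _ = cong suc (length-filter+filter∁ Q? l)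
... | no _ = trans (+-suc (length (filter Q? l)) _) (cong suc (length-filter+filter∁ Q? l))

filter-split : (Q? : Decidable Q) → ∀ l → (∀ {x y} → x ∷ y ∷ [] ⊆ l → ¬ Q x → ¬ Q y) →
  l ≡ filter Q? l ++ filter (∁? Q?) l
filter-split Q? [] _ = refl
filter-split Q? (x ∷ l) later with Q? x
... | yes _ = cong (x ∷_) (filter-split Q? l (λ p → later (x ∷ʳ p)))
... | no ¬qx = cong₂ (λ u v → u ++ x ∷ v) (sym (filter-none Q? none)) (sym (filter-all (∁? Q?) none))
  where
  none : All (∁ _) l
  none = All.tabulate (λ x∈l → later (refl ∷ from∈ x∈l) ¬qx)

filter-split∁ : (Q? : Decidable Q) → ∀ l → (∀ {x y} → x ∷ y ∷ [] ⊆ l → Q x → Q y) →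
  l ≡ filter (∁? Q?) l ++ filter Q? l
filter-split∁ Q? [] _ = refl
filter-split∁ Q? (x ∷ l) later with Q? x
... | no _ = cong (x ∷_) (filter-split∁ Q? l (λ p → later (x ∷ʳ p)))
... | yes qx = cong₂ (λ u v → u ++ x ∷ v) (sym (filter-none (∁? Q?) (All-¬¬ all))) (sym (filter-all Q? all))
  where
  all : All _ l
  all = All.tabulate (λ x∈l → later (refl ∷ from∈ x∈l) qx)

-- Flipping the blocks below and above the first entry

-- `arrange b` lets one argument cover both block orders: `flipBlocks true` turns
-- 231-avoiders into 213-avoiders and `flipBlocks false` turns them back.
arrange : Bool → List ℕ → List ℕ → List ℕ
arrange true xs ys = xs ++ ys
arrange false xs ys = ys ++ xs

⊆-arrangeˡ : ∀ b → ws ⊆ xs → ws ⊆ arrange b xs ys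
⊆-arrangeˡ {ys = ys} true p = ++⁺ʳ ys p
⊆-arrangeˡ {ys = ys} false p = ++⁺ˡ ys p

⊆-arrangeʳ : ∀ b → ws ⊆ ys → ws ⊆ arrange b xs ys
⊆-arrangeʳ {xs = xs} true p = ++⁺ˡ xs p
⊆-arrangeʳ {xs = xs} false p = ++⁺ʳ xs p

⊆-arrange⁻ˡ : ∀ b → All Q ws → All (∁ Q) ys → ws ⊆ arrange b xs ys → ws ⊆ xs
⊆-arrange⁻ˡ true = ⊆-++⁻ˡ
⊆-arrange⁻ˡ false = ⊆-++⁻ʳ

⊆-arrange⁻ʳ : ∀ b → All Q ws → All (∁ Q) xs → ws ⊆ arrange b xs ys → ws ⊆ ys
⊆-arrange⁻ʳ true = ⊆-++⁻ʳ
⊆-arrange⁻ʳ false = ⊆-++⁻ˡ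

All-arrange : ∀ b → All Q xs → All Q ys → All Q (arrange b xs ys)
All-arrange true a a′ = All-++⁺ a a′
All-arrange false a a′ = All-++⁺ a′ a

length-arrange : ∀ b xs ys → length (arrange b xs ys) ≡ length xs + length ys
length-arrange true xs ys = length-++ xs
length-arrange false xs ys = trans (length-++ ys) (+-comm (length ys) (length xs))

filter-arrange : ∀ b (Q? : Decidable Q) → All Q xs → All (∁ Q) ys → filter Q? (arrange b xs ys) ≡ xs
filter-arrange {xs = xs} {ys} true Q? a a′ = begin
  filter Q? (xs ++ ys)        ≡⟨ filter-++ Q? xs ys ⟩
  filter Q? xs ++ filter Q? ys ≡⟨ cong₂ _++_ (filter-all Q? a) (filter-none Q? a′) ⟩
  xs ++ []                    ≡⟨ ++-identityʳ xs ⟩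
  xs                          ∎
  where open ≡-Reasoning
filter-arrange {xs = xs} {ys} false Q? a a′ = begin
  filter Q? (ys ++ xs)        ≡⟨ filter-++ Q? ys xs ⟩
  filter Q? ys ++ filter Q? xs ≡⟨ cong₂ _++_ (filter-none Q? a′) (filter-all Q? a) ⟩
  xs                          ∎
  where open ≡-Reasoning

filter-arrangeʳ : ∀ b (Q? : Decidable Q) → All (∁ Q) xs → All Q ys → filter Q? (arrange b xs ys) ≡ ys
filter-arrangeʳ true Q? a a′ = filter-arrange false Q? a′ a
filter-arrangeʳ false Q? a a′ = filter-arrange true Q? a′ a

-- The ℕ argument is fuel; it is harmless as soon as it is at least the length of the list.
flipBlocks : Bool → ℕ → List ℕ → List ℕ
flipTail : Bool → ℕ → ℕ → List ℕ → List ℕ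

flipBlocks b zero l = l
flipBlocks b (suc f) [] = []
flipBlocks b (suc f) (m ∷ r) = m ∷ flipTail b f m r

flipTail b f m r = arrange b (flipBlocks b f (above m r)) (flipBlocks b f (below m r))

All-flipBlocks : ∀ b f → All Q l → All Q (flipBlocks b f l)
All-flipTail : ∀ b f m → All Q r → All Q (flipTail b f m r)

All-flipBlocks b zero a = a
All-flipBlocks b (suc f) [] = []
All-flipBlocks {l = m ∷ r} b (suc f) (qm ∷ a) = qm ∷ All-flipTail b f m a

All-flipTail b f m a = All-arrange b
  (All-flipBlocks b f (All-filter⁺ (∁? (_<? m)) a))
  (All-flipBlocks b f (All-filter⁺ (_<? m) a))

All-flipAbove : ∀ b f m r → All (∁ (_< m)) (flipBlocks b f (above m r))
All-flipAbove b f m r = All-flipBlocks b f (all-filter (∁? (_<? m)) r)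

All-flipBelow : ∀ b f m r → All (_< m) (flipBlocks b f (below m r))
All-flipBelow b f m r = All-flipBlocks b f (all-filter (_<? m) r)

Distinct-below : Distinct (m ∷ r) → Distinct (below m r)
Distinct-below {m} {r} d = Distinct-⊆ (filter-⊆ (_<? m) r) (Distinct-tail d)

Distinct-above : Distinct (m ∷ r) → Distinct (above m r)
Distinct-above {m} {r} d = Distinct-⊆ (filter-⊆ (∁? (_<? m)) r) (Distinct-tail d)

Free-below : ∀ {P} → Free P (m ∷ r) → Free P (below m r)
Free-below {m} {r} = Free-⊆ (m ∷ʳ filter-⊆ (_<? m) r)

Free-above : ∀ {P} → Free P (m ∷ r) → Free P (above m r)
Free-above {m} {r} = Free-⊆ (m ∷ʳ filter-⊆ (∁? (_<? m)) r)

length-below-≤ : ∀ m r → length r ≤ f → length (below m r) ≤ f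
length-below-≤ m r = ≤-trans (length-filter (_<? m) r)

length-above-≤ : ∀ m r → length r ≤ f → length (above m r) ≤ f
length-above-≤ m r = ≤-trans (length-filter (∁? (_<? m)) r)

All-flipAbove-> : ∀ b f → Distinct (m ∷ r) → All (m <_) (flipBlocks b f (above m r))
All-flipAbove-> {m} {r} b f d = All.zipWith (λ (x≮m , x≢m) → ≮∧≢⇒> x≮m x≢m)
  (All-flipAbove b f m r , All-flipBlocks b f (All-filter⁺ (∁? (_<? m)) (Distinct-head d)))

∈-flipTail⁻ : ∀ b f m → [ x ] ⊆ flipTail b f m r → [ x ] ⊆ r
∈-flipTail⁻ b f m = lookup⊆ (All-flipTail b f m (All.tabulate from∈))

length-flipBlocks : ∀ b f l → length (flipBlocks b f l) ≡ length l
length-flipBlocks b zero l = refl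
length-flipBlocks b (suc f) [] = refl
length-flipBlocks b (suc f) (m ∷ r) = cong suc (begin
  length (arrange b (flipBlocks b f (above m r)) (flipBlocks b f (below m r)))
    ≡⟨ length-arrange b _ _ ⟩
  length (flipBlocks b f (above m r)) + length (flipBlocks b f (below m r))
    ≡⟨ cong₂ _+_ (length-flipBlocks b f (above m r)) (length-flipBlocks b f (below m r)) ⟩
  length (above m r) + length (below m r)
    ≡⟨ +-comm (length (above m r)) _ ⟩
  length (below m r) + length (above m r)
    ≡⟨ length-filter+filter∁ (_<? m) r ⟩
  length r ∎)
  where open ≡-Reasoning

∈-flipBlocks : ∀ b f → [ x ] ⊆ l → [ x ] ⊆ flipBlocks b f l
∈-flipTail⁺ : ∀ b f m → [ x ] ⊆ r → [ x ] ⊆ flipTail b f m r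

∈-flipBlocks b zero p = p
∈-flipBlocks {l = m ∷ r} b (suc f) (refl ∷ p) = refl ∷ []⊆-universal _
∈-flipBlocks {l = m ∷ r} b (suc f) (.m ∷ʳ p) = m ∷ʳ ∈-flipTail⁺ b f m p

∈-flipTail⁺ {x} b f m p with x <? m
... | yes x<m = ⊆-arrangeʳ b (∈-flipBlocks b f (⊆-filter (_<? m) (x<m ∷ []) p))
... | no x≮m = ⊆-arrangeˡ b (∈-flipBlocks b f (⊆-filter (∁? (_<? m)) (x≮m ∷ []) p))

Distinct-flipBlocks : ∀ b f → Distinct l → Distinct (flipBlocks b f l)
Distinct-flipBlocks b zero d = d
Distinct-flipBlocks {[]} b (suc f) d = d
Distinct-flipBlocks {m ∷ r} b (suc f) d (refl ∷ p) = lookup⊆ (All-flipTail b f m (Distinct-head d)) p refl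
Distinct-flipBlocks {m ∷ r} b (suc f) d {x} (.m ∷ʳ p) with x <? m
... | yes x<m = Distinct-flipBlocks b f (Distinct-below d)
  (⊆-arrange⁻ʳ b (x<m ∷ x<m ∷ []) (All-flipAbove b f m r) p)
... | no x≮m = Distinct-flipBlocks b f (Distinct-above d)
  (⊆-arrange⁻ˡ b (x≮m ∷ x≮m ∷ []) (All-¬¬ (All-flipBelow b f m r)) p)

flipBlocks-consecutive⁻ : ∀ b f → Distinct l → Consecutive x y →
  x ∷ y ∷ [] ⊆ flipBlocks b f l → x ∷ y ∷ [] ⊆ l
flipBlocks-consecutive⁻ b zero d c p = p
flipBlocks-consecutive⁻ {[]} b (suc f) d c p = p
flipBlocks-consecutive⁻ {m ∷ r} b (suc f) d c (refl ∷ p) = refl ∷ ∈-flipTail⁻ b f m p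
flipBlocks-consecutive⁻ {m ∷ r} {x} {y} b (suc f) d c (.m ∷ʳ p) with x ≟ m | y ≟ m
... | yes refl | _ = refl ∷ ∈-flipTail⁻ b f m (∷ˡ⁻ p)
... | no _ | yes refl = ⊥-elim (lookup⊆ (All-flipTail b f m (Distinct-head d)) (∷ˡ⁻ p) refl)
... | no x≢m | no y≢m with Consecutive-same-side c x≢m y≢m
...   | inj₁ (x<m , y<m) = m ∷ʳ ⊆-trans
  (flipBlocks-consecutive⁻ b f (Distinct-below d) c
    (⊆-arrange⁻ʳ b (x<m ∷ y<m ∷ []) (All-flipAbove b f m r) p))
  (filter-⊆ (_<? m) r)
...   | inj₂ (x≮m , y≮m) = m ∷ʳ ⊆-trans
  (flipBlocks-consecutive⁻ b f (Distinct-above d) c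
    (⊆-arrange⁻ˡ b (x≮m ∷ y≮m ∷ []) (All-¬¬ (All-flipBelow b f m r)) p))
  (filter-⊆ (∁? (_<? m)) r)

flipBlocks-consecutive⁺ : ∀ b f → Distinct l → Consecutive x y →
  x ∷ y ∷ [] ⊆ l → x ∷ y ∷ [] ⊆ flipBlocks b f l
flipBlocks-consecutive⁺ b zero d c p = p
flipBlocks-consecutive⁺ {[]} b (suc f) d c p = p
flipBlocks-consecutive⁺ {m ∷ r} b (suc f) d c (refl ∷ p) = refl ∷ ∈-flipTail⁺ b f m p
flipBlocks-consecutive⁺ {m ∷ r} {x} {y} b (suc f) d c (.m ∷ʳ p) with x ≟ m | y ≟ m
... | yes refl | _ = ⊥-elim (lookup⊆ (Distinct-head d) (head⊆ p) refl)
... | no _ | yes refl = ⊥-elim (lookup⊆ (Distinct-head d) (∷ˡ⁻ p) refl)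
... | no x≢m | no y≢m with Consecutive-same-side c x≢m y≢m
...   | inj₁ (x<m , y<m) = m ∷ʳ ⊆-arrangeʳ b
  (flipBlocks-consecutive⁺ b f (Distinct-below d) c
    (⊆-filter (_<? m) (x<m ∷ y<m ∷ []) p))
...   | inj₂ (x≮m , y≮m) = m ∷ʳ ⊆-arrangeˡ b
  (flipBlocks-consecutive⁺ b f (Distinct-above d) c
    (⊆-filter (∁? (_<? m)) (x≮m ∷ y≮m ∷ []) p))

Free213-∷ : All (m <_) xs → All (_< m) ys → Free Is213 xs → Free Is213 ys → Free Is213 (m ∷ xs ++ ys)
Free213-∷ {xs = xs} >m <m fX fY (refl ∷ p) (b<m , m<c) with ⊆-++-split xs p
... | [] , _ , refl , _ , q = <-asym m<c (lookup⊆ <m (∷ˡ⁻ q))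
... | _ ∷ [] , _ , refl , q , _ = <-asym b<m (lookup⊆ >m q)
... | _ ∷ _ ∷ [] , _ , refl , q , _ = <-asym b<m (lookup⊆ >m (head⊆ q))
... | _ ∷ _ ∷ _ ∷ _ , _ , () , _
Free213-∷ {xs = xs} >m <m fX fY (_ ∷ʳ p) (b<a , a<c) with ⊆-++-split xs p
... | [] , _ , refl , _ , q = fY q (b<a , a<c)
... | _ ∷ [] , _ , refl , q , q′ = <-asym a<c (<-trans (lookup⊆ <m (∷ˡ⁻ q′)) (lookup⊆ >m q))
... | _ ∷ _ ∷ [] , _ , refl , q , q′ = <-asym a<c (<-trans (lookup⊆ <m q′) (lookup⊆ >m (head⊆ q)))
... | _ ∷ _ ∷ _ ∷ [] , _ , refl , q , _ = fX q (b<a , a<c)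
... | _ ∷ _ ∷ _ ∷ _ ∷ _ , _ , () , _

Free231-∷ : All (m <_) xs → All (_< m) ys → Free Is231 xs → Free Is231 ys → Free Is231 (m ∷ ys ++ xs)
Free231-∷ {ys = ys} >m <m fX fY (refl ∷ p) (c<m , m<b) with ⊆-++-split ys p
... | [] , _ , refl , _ , q = <-asym c<m (lookup⊆ >m (∷ˡ⁻ q))
... | _ ∷ [] , _ , refl , q , _ = <-asym m<b (lookup⊆ <m q)
... | _ ∷ _ ∷ [] , _ , refl , q , _ = <-asym m<b (lookup⊆ <m (head⊆ q))
... | _ ∷ _ ∷ _ ∷ _ , _ , () , _
Free231-∷ {ys = ys} >m <m fX fY (_ ∷ʳ p) (c<a , a<b) with ⊆-++-split ys p
... | [] , _ , refl , _ , q = fX q (c<a , a<b)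
... | _ ∷ [] , _ , refl , q , q′ = <-asym c<a (<-trans (lookup⊆ <m q) (lookup⊆ >m (∷ˡ⁻ q′)))
... | _ ∷ _ ∷ [] , _ , refl , q , q′ = <-asym c<a (<-trans (lookup⊆ <m (head⊆ q)) (lookup⊆ >m q′))
... | _ ∷ _ ∷ _ ∷ [] , _ , refl , q , _ = fY q (c<a , a<b)
... | _ ∷ _ ∷ _ ∷ _ ∷ _ , _ , () , _

Source Target : Bool → Pattern
Source true = Is231
Source false = Is213
Target true = Is213
Target false = Is231

Free-flipBlocks : ∀ b f → length l ≤ f → Distinct l → Free (Source b) l → Free (Target b) (flipBlocks b f l)
Free-flipBlocks {[]} b zero _ _ _ ()
Free-flipBlocks {[]} b (suc f) _ _ _ ()
Free-flipBlocks {m ∷ r} b (suc f) (s≤s len≤f) d free = Free-∷ b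
  (All-flipAbove-> b f d) (All-flipBelow b f m r)
  (Free-flipBlocks b f (length-above-≤ m r len≤f) (Distinct-above d) (Free-above free))
  (Free-flipBlocks b f (length-below-≤ m r len≤f) (Distinct-below d) (Free-below free))
  where
  Free-∷ : ∀ b {xs ys} → All (m <_) xs → All (_< m) ys → Free (Target b) xs → Free (Target b) ys →
    Free (Target b) (m ∷ arrange b xs ys)
  Free-∷ true = Free213-∷
  Free-∷ false = Free231-∷

Source-split : ∀ b → Distinct (m ∷ r) → Free (Source b) (m ∷ r) → r ≡ arrange (not b) (above m r) (below m r)
Source-split {m} {r} true d free = filter-split (_<? m) r later
  where
  later : x ∷ y ∷ [] ⊆ r → ¬ x < m → ¬ y < m
  later p x≮m y<m = free (refl ∷ p) (y<m , ≮∧≢⇒> x≮m (lookup⊆ (Distinct-head d) (head⊆ p)))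
Source-split {m} {r} false d free = filter-split∁ (_<? m) r later
  where
  later : x ∷ y ∷ [] ⊆ r → x < m → y < m
  later {y = y} p x<m with y <? m
  ... | yes y<m = y<m
  ... | no y≮m = ⊥-elim (free (refl ∷ p) (x<m , ≮∧≢⇒> y≮m (lookup⊆ (Distinct-head d) (∷ˡ⁻ p))))

flipBlocks-[] : ∀ b f → flipBlocks b f [] ≡ []
flipBlocks-[] b zero = refl
flipBlocks-[] b (suc f) = refl

flipBlocks-inverse : ∀ b f f′ → length l ≤ f → length l ≤ f′ → Distinct l → Free (Source b) l →
  flipBlocks (not b) f′ (flipBlocks b f l) ≡ l
flipBlocks-inverse {[]} b f f′ _ _ _ _ =
  trans (cong (flipBlocks (not b) f′) (flipBlocks-[] b f)) (flipBlocks-[] (not b) f′)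
flipBlocks-inverse {m ∷ r} b (suc f) (suc f′) (s≤s len≤f) (s≤s len≤f′) d free = cong (m ∷_) (begin
  arrange (not b) (flipBlocks (not b) f′ (above m T)) (flipBlocks (not b) f′ (below m T))
    ≡⟨ cong₂ (λ u v → arrange (not b) (flipBlocks (not b) f′ u) (flipBlocks (not b) f′ v)) above-T below-T ⟩
  arrange (not b) (flipBlocks (not b) f′ X) (flipBlocks (not b) f′ Y)
    ≡⟨ cong₂ (arrange (not b))
         (flipBlocks-inverse b f f′ (length-above-≤ m r len≤f) (length-above-≤ m r len≤f′)
           (Distinct-above d) (Free-above free))
         (flipBlocks-inverse b f f′ (length-below-≤ m r len≤f) (length-below-≤ m r len≤f′)
           (Distinct-below d) (Free-below free)) ⟩
  arrange (not b) (above m r) (below m r)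
    ≡⟨ sym (Source-split b d free) ⟩
  r ∎)
  where
  open ≡-Reasoning
  X = flipBlocks b f (above m r)
  Y = flipBlocks b f (below m r)
  T = flipTail b f m r
  above-T : above m T ≡ X
  above-T = filter-arrange b (∁? (_<? m)) (All-flipAbove b f m r) (All-¬¬ (All-flipBelow b f m r))
  below-T : below m T ≡ Y
  below-T = filter-arrangeʳ b (_<? m) (All-flipAbove b f m r) (All-flipBelow b f m r)

record ConsecutiveOrderInjection (P P′ : Pattern) : Set₁ where
  field
    to from : List ℕ → List ℕ
    All-to : ∀ {R : Pred ℕ 0ℓ} l → All R l → All R (to l)
    length-to : ∀ l → length (to l) ≡ length l
    Distinct-to : ∀ l → Distinct l → Distinct (to l)
    Free-to : ∀ l → Distinct l → Free P l → Free P′ (to l)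
    to-consecutive⁻ : ∀ l → Distinct l → Consecutive x y → x ∷ y ∷ [] ⊆ to l → x ∷ y ∷ [] ⊆ l
    to-consecutive⁺ : ∀ l → Distinct l → Consecutive x y → x ∷ y ∷ [] ⊆ l → x ∷ y ∷ [] ⊆ to l
    from∘to : ∀ l → Distinct l → Free P l → from (to l) ≡ l

flipBlocks-injection : ∀ b → ConsecutiveOrderInjection (Source b) (Target b)
flipBlocks-injection b = record
  { to = λ l → flipBlocks b (length l) l
  ; from = λ l → flipBlocks (not b) (length l) l
  ; All-to = λ l → All-flipBlocks b (length l)
  ; length-to = λ l → length-flipBlocks b (length l) l
  ; Distinct-to = λ l → Distinct-flipBlocks b (length l)
  ; Free-to = λ l → Free-flipBlocks b (length l) ≤-refl
  ; to-consecutive⁻ = λ l → flipBlocks-consecutive⁻ b (length l)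
  ; to-consecutive⁺ = λ l → flipBlocks-consecutive⁺ b (length l)
  ; from∘to = λ l → flipBlocks-inverse b (length l) _ ≤-refl (≤-reflexive (sym (length-flipBlocks b (length l) l)))
  }

reverse-injection : ∀ {P P′} → ConsecutiveOrderInjection P P′ →
  ConsecutiveOrderInjection (Reversed P) (Reversed P′)
reverse-injection {P} {P′} ι = record
  { to = λ l → reverse (to (reverse l))
  ; from = λ l → reverse (from (reverse l))
  ; All-to = λ l a → All-reverse (All-to (reverse l) (All-reverse a))
  ; length-to = λ l → trans (length-reverse (to (reverse l))) (trans (length-to (reverse l)) (length-reverse l))
  ; Distinct-to = λ l d → Distinct-reverse (Distinct-to (reverse l) (Distinct-reverse d))
  ; Free-to = λ l d free → Free-reverse (Free-to (reverse l) (Distinct-reverse d) (Free-reverse free))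
  ; to-consecutive⁻ = consecutive⁻
  ; to-consecutive⁺ = λ l d c p →
      reverse⁺ (to-consecutive⁺ (reverse l) (Distinct-reverse d) (Consecutive-sym c) (reverse⁺ p))
  ; from∘to = from∘to′
  }
  where
  open ConsecutiveOrderInjection ι
  consecutive⁻ : ∀ l → Distinct l → Consecutive x y →
    x ∷ y ∷ [] ⊆ reverse (to (reverse l)) → x ∷ y ∷ [] ⊆ l
  consecutive⁻ {x} {y} l d c p = subst (x ∷ y ∷ [] ⊆_) (reverse-involutive l) (reverse⁺
    (to-consecutive⁻ (reverse l) (Distinct-reverse d) (Consecutive-sym c) (reverse⁻ {as = y ∷ x ∷ []} p)))
  from∘to′ : ∀ l → Distinct l → Free (Reversed P) l → reverse (from (reverse (reverse (to (reverse l))))) ≡ l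
  from∘to′ l d free = begin
    reverse (from (reverse (reverse (to (reverse l)))))
      ≡⟨ cong (reverse ∘ from) (reverse-involutive (to (reverse l))) ⟩
    reverse (from (to (reverse l)))
      ≡⟨ cong reverse (from∘to (reverse l) (Distinct-reverse d) (Free-reverse free)) ⟩
    reverse (reverse l)
      ≡⟨ reverse-involutive l ⟩
    l ∎
    where open ≡-Reasoning

-- Permutations as lists of values

values : ∀ {n m} → Vec (Fin n) m → List ℕ
values v = toList (Vec.map toℕ v)

length-values : ∀ {n m} (v : Vec (Fin n) m) → length (values v) ≡ m
length-values [] = refl
length-values (x ∷ v) = cong suc (length-values v)

All-values : ∀ {n m} (v : Vec (Fin n) m) → All (_< n) (values v)
All-values [] = []
All-values (x ∷ v) = toℕ<n x ∷ All-values v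

-- Out-of-range values decode to 0; by `values-decode` this never happens on the lists we decode.
decodeValue : ∀ {n} → ℕ → Fin (suc n)
decodeValue {n} x with x <? suc n
... | yes x<n = fromℕ< x<n
... | no _ = f0

decodeVec : ∀ {n} m → List ℕ → Vec (Fin (suc n)) m
decodeVec zero _ = []
decodeVec (suc m) [] = f0 ∷ decodeVec m []
decodeVec (suc m) (x ∷ l) = decodeValue x ∷ decodeVec m l

decode : ∀ n → List ℕ → Word n
decode zero _ = []
decode (suc n) l = decodeVec (suc n) l

decodeValue-toℕ : ∀ {n} (i : Fin (suc n)) → decodeValue {n} (toℕ i) ≡ i
decodeValue-toℕ {n} i with toℕ i <? suc n
... | yes i<n = fromℕ<-toℕ i i<n
... | no i≮n = ⊥-elim (i≮n (toℕ<n i))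

toℕ-decodeValue : ∀ {n} x → x < suc n → toℕ (decodeValue {n} x) ≡ x
toℕ-decodeValue {n} x x<n with x <? suc n
... | yes x<n′ = toℕ-fromℕ< x<n′
... | no x≮n = ⊥-elim (x≮n x<n)

decodeVec-values : ∀ {n m} (v : Vec (Fin (suc n)) m) → decodeVec m (values v) ≡ v
decodeVec-values [] = refl
decodeVec-values (x ∷ v) = cong₂ _∷_ (decodeValue-toℕ x) (decodeVec-values v)

values-decodeVec : ∀ {n} m l → length l ≡ m → All (_< suc n) l → values (decodeVec {n} m l) ≡ l
values-decodeVec zero [] _ _ = refl
values-decodeVec (suc m) (x ∷ l) len (x<n ∷ l<n) =
  cong₂ _∷_ (toℕ-decodeValue x x<n) (values-decodeVec m l (suc-injective len) l<n)

decode-values : ∀ {n} (π : Word n) → decode n (values π) ≡ π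
decode-values {zero} [] = refl
decode-values {suc n} π = decodeVec-values π

values-decode : ∀ n l → length l ≡ n → All (_< n) l → values (decode n l) ≡ l
values-decode zero [] _ _ = refl
values-decode (suc n) l = values-decodeVec (suc n) l

lookup∈values : ∀ {n m} (v : Vec (Fin n) m) i → [ toℕ (lookup v i) ] ⊆ values v
lookup∈values (x ∷ v) f0 = refl ∷ []⊆-universal _
lookup∈values (x ∷ v) (fs i) = _ ∷ʳ lookup∈values v i

lookup²⊆values : ∀ {n m} (v : Vec (Fin n) m) i j → i Fin.< j →
  toℕ (lookup v i) ∷ toℕ (lookup v j) ∷ [] ⊆ values v
lookup²⊆values (x ∷ v) f0 (fs j) _ = refl ∷ lookup∈values v j
lookup²⊆values (x ∷ v) (fs i) (fs j) (s≤s i<j) = _ ∷ʳ lookup²⊆values v i j i<j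

lookup³⊆values : ∀ {n m} (v : Vec (Fin n) m) i j k → i Fin.< j → j Fin.< k →
  toℕ (lookup v i) ∷ toℕ (lookup v j) ∷ toℕ (lookup v k) ∷ [] ⊆ values v
lookup³⊆values (x ∷ v) f0 (fs j) (fs k) _ (s≤s j<k) = refl ∷ lookup²⊆values v j k j<k
lookup³⊆values (x ∷ v) (fs i) (fs j) (fs k) (s≤s i<j) (s≤s j<k) = _ ∷ʳ lookup³⊆values v i j k i<j j<k

∈values⇒lookup : ∀ {n m} (v : Vec (Fin n) m) {a} → [ a ] ⊆ values v → ∃ λ i → toℕ (lookup v i) ≡ a
∈values⇒lookup (x ∷ v) (refl ∷ _) = f0 , refl
∈values⇒lookup (x ∷ v) (_ ∷ʳ p) with ∈values⇒lookup v p
... | i , e = fs i , e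

⊆values⇒lookup² : ∀ {n m} (v : Vec (Fin n) m) {a b} → a ∷ b ∷ [] ⊆ values v →
  ∃₂ λ i j → i Fin.< j × toℕ (lookup v i) ≡ a × toℕ (lookup v j) ≡ b
⊆values⇒lookup² (x ∷ v) (refl ∷ p) with ∈values⇒lookup v p
... | j , e = f0 , fs j , s≤s z≤n , refl , e
⊆values⇒lookup² (x ∷ v) (_ ∷ʳ p) with ⊆values⇒lookup² v p
... | i , j , i<j , e , e′ = fs i , fs j , s≤s i<j , e , e′

⊆values⇒lookup³ : ∀ {n m} (v : Vec (Fin n) m) {a b c} → a ∷ b ∷ c ∷ [] ⊆ values v →
  ∃ λ i → ∃₂ λ j k → i Fin.< j × j Fin.< k ×
    toℕ (lookup v i) ≡ a × toℕ (lookup v j) ≡ b × toℕ (lookup v k) ≡ c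
⊆values⇒lookup³ (x ∷ v) (refl ∷ p) with ⊆values⇒lookup² v p
... | j , k , j<k , e , e′ = f0 , fs j , fs k , s≤s z≤n , s≤s j<k , refl , e , e′
⊆values⇒lookup³ (x ∷ v) (_ ∷ʳ p) with ⊆values⇒lookup³ v p
... | i , j , k , i<j , j<k , e , e′ , e″ = fs i , fs j , fs k , s≤s i<j , s≤s j<k , e , e′ , e″

IsPerm⇒Distinct : ∀ {n} (π : Word n) → IsPerm π → Distinct (values π)
IsPerm⇒Distinct π perm p with ⊆values⇒lookup² π p
... | i , j , i<j , e , e′ = <-irrefl (cong toℕ (perm i j (toℕ-injective (trans e (sym e′))))) i<j

Distinct⇒IsPerm : ∀ {n} (π : Word n) → Distinct (values π) → IsPerm π
Distinct⇒IsPerm π d i j e with <-cmp i j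
... | tri≈ _ i≡j _ = i≡j
... | tri< i<j _ _ =
  ⊥-elim (d (subst (λ u → toℕ (lookup π i) ∷ toℕ u ∷ [] ⊆ values π) (sym e) (lookup²⊆values π i j i<j)))
... | tri> _ _ j<i =
  ⊥-elim (d (subst (λ u → toℕ u ∷ toℕ (lookup π i) ∷ [] ⊆ values π) (sym e) (lookup²⊆values π j i j<i)))

LeftOf⇒⊆values : ∀ {n} (π : Word n) {u w} → LeftOf π u w → toℕ u ∷ toℕ w ∷ [] ⊆ values π
LeftOf⇒⊆values π (p , p′ , p<p′ , refl , refl) = lookup²⊆values π p p′ p<p′

⊆values⇒LeftOf : ∀ {n} (π : Word n) {u w} → toℕ u ∷ toℕ w ∷ [] ⊆ values π → LeftOf π u w
⊆values⇒LeftOf π q with ⊆values⇒lookup² π q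
... | i , j , i<j , e , e′ = i , j , i<j , toℕ-injective e , toℕ-injective e′

record Represents (σ : Vec (Fin 3) 3) (P : Pattern) : Set where
  field
    OrdIso⇔ : ∀ {n} (x : Fin 3 → Fin n) →
      OrdIso x σ ⇔ P (toℕ (x f0)) (toℕ (x (fs f0))) (toℕ (x (fs (fs f0))))

OrdIso-from-< : ∀ {n} σ (x : Fin 3 → Fin n) → IsPerm σ →
  (∀ a b → lookup σ a Fin.< lookup σ b → x a Fin.< x b) → OrdIso x σ
OrdIso-from-< σ x σ-perm mono a b = reflect , mono a b
  where
  reflect : x a Fin.< x b → lookup σ a Fin.< lookup σ b
  reflect xa<xb with <-cmp (lookup σ a) (lookup σ b)
  ... | tri< σa<σb _ _ = σa<σb
  ... | tri≈ _ σa≡σb _ = ⊥-elim (<-irrefl (cong (toℕ ∘ x) (σ-perm a b σa≡σb)) xa<xb)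
  ... | tri> _ _ σb<σa = ⊥-elim (<-asym xa<xb (mono b a σb<σa))

represents-231 : Represents p231 Is231
represents-231 = record { OrdIso⇔ = λ x → mk⇔
  (λ iso → proj₂ (iso (fs (fs f0)) f0) (s≤s z≤n) , proj₂ (iso f0 (fs f0)) (s≤s (s≤s z≤n)))
  (λ pat → OrdIso-from-< p231 x (toWitness {a? = isPerm? p231} _) (mono x pat)) }
  where
  mono : ∀ {n} (x : Fin 3 → Fin n) → Is231 (toℕ (x f0)) (toℕ (x (fs f0))) (toℕ (x (fs (fs f0)))) →
    ∀ a b → lookup p231 a Fin.< lookup p231 b → x a Fin.< x b
  mono _ (x2<x0 , x0<x1) f0 (fs f0) _ = x0<x1
  mono _ (x2<x0 , x0<x1) (fs (fs f0)) f0 _ = x2<x0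
  mono _ (x2<x0 , x0<x1) (fs (fs f0)) (fs f0) _ = <-trans x2<x0 x0<x1
  mono _ _ f0 f0 (s≤s ())
  mono _ _ f0 (fs (fs f0)) ()
  mono _ _ (fs f0) f0 (s≤s ())
  mono _ _ (fs f0) (fs f0) (s≤s (s≤s ()))
  mono _ _ (fs f0) (fs (fs f0)) ()
  mono _ _ (fs (fs f0)) (fs (fs f0)) ()

represents-213 : Represents p213 Is213
represents-213 = record { OrdIso⇔ = λ x → mk⇔
  (λ iso → proj₂ (iso (fs f0) f0) (s≤s z≤n) , proj₂ (iso f0 (fs (fs f0))) (s≤s (s≤s z≤n)))
  (λ pat → OrdIso-from-< p213 x (toWitness {a? = isPerm? p213} _) (mono x pat)) }
  where
  mono : ∀ {n} (x : Fin 3 → Fin n) → Is213 (toℕ (x f0)) (toℕ (x (fs f0))) (toℕ (x (fs (fs f0)))) →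
    ∀ a b → lookup p213 a Fin.< lookup p213 b → x a Fin.< x b
  mono _ (x1<x0 , x0<x2) f0 (fs (fs f0)) _ = x0<x2
  mono _ (x1<x0 , x0<x2) (fs f0) f0 _ = x1<x0
  mono _ (x1<x0 , x0<x2) (fs f0) (fs (fs f0)) _ = <-trans x1<x0 x0<x2
  mono _ _ f0 f0 (s≤s ())
  mono _ _ f0 (fs f0) ()
  mono _ _ (fs f0) (fs f0) ()
  mono _ _ (fs (fs f0)) f0 (s≤s ())
  mono _ _ (fs (fs f0)) (fs f0) ()
  mono _ _ (fs (fs f0)) (fs (fs f0)) (s≤s (s≤s ()))

represents-312 : Represents p312 Is312
represents-312 = record { OrdIso⇔ = λ x → mk⇔
  (λ iso → proj₂ (iso (fs f0) (fs (fs f0))) (s≤s z≤n) , proj₂ (iso (fs (fs f0)) f0) (s≤s (s≤s z≤n)))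
  (λ pat → OrdIso-from-< p312 x (toWitness {a? = isPerm? p312} _) (mono x pat)) }
  where
  mono : ∀ {n} (x : Fin 3 → Fin n) → Is312 (toℕ (x f0)) (toℕ (x (fs f0))) (toℕ (x (fs (fs f0)))) →
    ∀ a b → lookup p312 a Fin.< lookup p312 b → x a Fin.< x b
  mono _ (x1<x2 , x2<x0) (fs f0) f0 _ = <-trans x1<x2 x2<x0
  mono _ (x1<x2 , x2<x0) (fs f0) (fs (fs f0)) _ = x1<x2
  mono _ (x1<x2 , x2<x0) (fs (fs f0)) f0 _ = x2<x0
  mono _ _ f0 f0 (s≤s (s≤s ()))
  mono _ _ f0 (fs f0) ()
  mono _ _ f0 (fs (fs f0)) (s≤s ())
  mono _ _ (fs f0) (fs f0) ()
  mono _ _ (fs (fs f0)) (fs f0) ()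
  mono _ _ (fs (fs f0)) (fs (fs f0)) (s≤s ())

represents-132 : Represents p132 Is132
represents-132 = record { OrdIso⇔ = λ x → mk⇔
  (λ iso → proj₂ (iso f0 (fs (fs f0))) (s≤s z≤n) , proj₂ (iso (fs (fs f0)) (fs f0)) (s≤s (s≤s z≤n)))
  (λ pat → OrdIso-from-< p132 x (toWitness {a? = isPerm? p132} _) (mono x pat)) }
  where
  mono : ∀ {n} (x : Fin 3 → Fin n) → Is132 (toℕ (x f0)) (toℕ (x (fs f0))) (toℕ (x (fs (fs f0)))) →
    ∀ a b → lookup p132 a Fin.< lookup p132 b → x a Fin.< x b
  mono _ (x0<x2 , x2<x1) f0 (fs f0) _ = <-trans x0<x2 x2<x1
  mono _ (x0<x2 , x2<x1) f0 (fs (fs f0)) _ = x0<x2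
  mono _ (x0<x2 , x2<x1) (fs (fs f0)) (fs f0) _ = x2<x1
  mono _ _ f0 f0 ()
  mono _ _ (fs f0) f0 ()
  mono _ _ (fs f0) (fs f0) (s≤s (s≤s ()))
  mono _ _ (fs f0) (fs (fs f0)) (s≤s ())
  mono _ _ (fs (fs f0)) f0 ()
  mono _ _ (fs (fs f0)) (fs (fs f0)) (s≤s ())

module _ {σ P} (rep : Represents σ P) where

  open Represents rep

  Avoids⇒Free : ∀ {n} (π : Word n) → Avoids π σ → Free P (values π)
  Avoids⇒Free π avoids q pat with ⊆values⇒lookup³ π q
  ... | i , j , k , i<j , j<k , refl , refl , refl =
    avoids (i , j , k , i<j , j<k , Equivalence.from (OrdIso⇔ _) pat)

  Free⇒Avoids : ∀ {n} (π : Word n) → Free P (values π) → Avoids π σ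
  Free⇒Avoids π free (i , j , k , i<j , j<k , iso) =
    free (lookup³⊆values π i j k i<j j<k) (Equivalence.to (OrdIso⇔ _) iso)

chv-cong : ∀ {n} (π π′ : Word n) v → (∀ w → suc (toℕ w) ≡ toℕ v → LeftOf π v w ⇔ LeftOf π′ v w) →
  chv π v ≡ chv π′ v
chv-cong π π′ v same with toℕ v in v≡
... | zero = refl
... | suc t with any? (λ w → (suc (toℕ w) ≟ toℕ v) ×-dec leftOf? π v w)
               | any? (λ w → (suc (toℕ w) ≟ toℕ v) ×-dec leftOf? π′ v w)
...   | yes _ | yes _ = refl
...   | no _ | no _ = refl
...   | yes (w , e , l) | no none = ⊥-elim (none (w , e , Equivalence.to (same w (trans e v≡)) l))
...   | no none | yes (w , e , l) = ⊥-elim (none (w , e , Equivalence.from (same w (trans e v≡)) l))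

ch-cong : ∀ {n} (π π′ : Word n) → (∀ v → chv π v ≡ chv π′ v) → ch π ≡ ch π′
ch-cong {n} π π′ e = cong sum (map-cong e (allFin n))

-- Counting through an injection

module _ {n : ℕ} where

  extend : ∀ {m} → Vec (Fin n) m → List (Vec (Fin n) (suc m))
  extend w = map (_∷ w) (allFin n)

  ∈-concatMap-extend : ∀ {m} {ws : List (Vec (Fin n) m)} {w} x → w ∈ ws → (x ∷ w) ∈ concatMap extend ws
  ∈-concatMap-extend {ws = w ∷ ws} x (here refl) = ∈-++⁺ˡ (∈-map⁺ (_∷ w) (∈-allFin x))
  ∈-concatMap-extend {ws = w ∷ ws} x (there p) = ∈-++⁺ʳ (extend w) (∈-concatMap-extend x p)

  ∈-concatMap-extend⁻ : ∀ {m} (ws : List (Vec (Fin n) m)) {w x} → (x ∷ w) ∈ concatMap extend ws → w ∈ ws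
  ∈-concatMap-extend⁻ (w ∷ ws) p with ∈-++⁻ (extend w) p
  ... | inj₁ q with ∈-map⁻ (_∷ w) q
  ...   | _ , _ , refl = here refl
  ∈-concatMap-extend⁻ (w ∷ ws) p | inj₂ q = there (∈-concatMap-extend⁻ ws q)

  concatMap-extend-unique : ∀ {m} (ws : List (Vec (Fin n) m)) → Unique ws → Unique (concatMap extend ws)
  concatMap-extend-unique [] _ = []
  concatMap-extend-unique (w ∷ ws) (w∉ws ∷ u) =
    Unique.++⁺ (Unique.map⁺ (λ { refl → refl }) (Unique.allFin⁺ n)) (concatMap-extend-unique ws u) disjoint
    where
    disjoint : ∀ {v} → ¬ (v ∈ extend w × v ∈ concatMap extend ws)
    disjoint (p , q) with ∈-map⁻ (_∷ w) p
    ... | _ , _ , refl = Unique.Unique[x∷xs]⇒x∉xs (w∉ws ∷ u) (∈-concatMap-extend⁻ ws q)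

  ∈-words : ∀ m (v : Vec (Fin n) m) → v ∈ words m
  ∈-words zero [] = here refl
  ∈-words (suc m) (x ∷ w) = ∈-concatMap-extend x (∈-words m w)

  words-unique : ∀ m → Unique (words {n} m)
  words-unique zero = [] ∷ []
  words-unique (suc m) = concatMap-extend-unique (words m) (words-unique m)

IsPerm⇒∈S : ∀ {n} (π : Word n) → IsPerm π → π ∈ S n
IsPerm⇒∈S {n} π perm = ∈-filter⁺ isPerm? (∈-words n π) perm

module _ {A : Set} where

  remove : ∀ {x : A} {ys} → x ∈ ys → List A
  remove {ys = _ ∷ ys} (here _) = ys
  remove {ys = y ∷ _} (there p) = y ∷ remove p

  length-remove : ∀ {x : A} {ys} (p : x ∈ ys) → length ys ≡ suc (length (remove p))
  length-remove (here _) = refl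
  length-remove (there p) = cong suc (length-remove p)

  ∈-remove : ∀ {x z : A} {ys} (p : x ∈ ys) → z ∈ ys → z ≢ x → z ∈ remove p
  ∈-remove (here refl) (here refl) z≢x = ⊥-elim (z≢x refl)
  ∈-remove (here refl) (there q) _ = q
  ∈-remove (there p) (here refl) _ = here refl
  ∈-remove (there p) (there q) z≢x = there (∈-remove p q z≢x)

  length-≤-injection : ∀ (xs ys : List A) (f : A → A) → Unique xs → (∀ {x} → x ∈ xs → f x ∈ ys) →
    (∀ {x y} → x ∈ xs → y ∈ xs → f x ≡ f y → x ≡ y) → length xs ≤ length ys
  length-≤-injection [] ys f _ _ _ = z≤n
  length-≤-injection (x ∷ xs) ys f (x∉xs ∷ u) into inj =
    subst (suc (length xs) ≤_) (sym (length-remove fx∈ys))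
      (s≤s (length-≤-injection xs (remove fx∈ys) f u into′ (λ p q → inj (there p) (there q))))
    where
    fx∈ys = into (here refl)
    into′ : ∀ {y} → y ∈ xs → f y ∈ remove fx∈ys
    into′ {y} y∈xs = ∈-remove fx∈ys (into (there y∈xs))
      (λ fy≡fx → Unique.Unique[x∷xs]⇒x∉xs (x∉xs ∷ u)
        (subst (_∈ xs) (inj (there y∈xs) (here refl) fy≡fx) y∈xs))

module Transport {σ τ P P′} (repσ : Represents σ P) (repτ : Represents τ P′)
                 (ι : ConsecutiveOrderInjection P P′) where

  open ConsecutiveOrderInjection ι

  transport : ∀ {n} → Word n → Word n
  transport {n} π = decode n (to (values π))

  values-transport : ∀ {n} (π : Word n) → values (transport π) ≡ to (values π)
  values-transport {n} π = values-decode n (to (values π))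
    (trans (length-to (values π)) (length-values π)) (All-to (values π) (All-values π))

  Avoider : ∀ {n} → Word n → Set
  Avoider π = IsPerm π × Avoids π σ

  transport-perm : ∀ {n} (π : Word n) → Avoider π → IsPerm (transport π)
  transport-perm π (perm , _) = Distinct⇒IsPerm (transport π)
    (subst Distinct (sym (values-transport π)) (Distinct-to (values π) (IsPerm⇒Distinct π perm)))

  transport-avoids : ∀ {n} (π : Word n) → Avoider π → Avoids (transport π) τ
  transport-avoids π (perm , avoids) = Free⇒Avoids repτ (transport π)
    (subst (Free P′) (sym (values-transport π))
      (Free-to (values π) (IsPerm⇒Distinct π perm) (Avoids⇒Free repσ π avoids)))

  ch-transport : ∀ {n} (π : Word n) → Avoider π → ch (transport π) ≡ ch π
  ch-transport π (perm , _) = ch-cong (transport π) π (λ v → chv-cong (transport π) π v (same-order v))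
    where
    d = IsPerm⇒Distinct π perm
    same-order : ∀ v w → suc (toℕ w) ≡ toℕ v → LeftOf (transport π) v w ⇔ LeftOf π v w
    same-order v w e = mk⇔
      (λ l → ⊆values⇒LeftOf π (to-consecutive⁻ (values π) d (inj₁ e)
        (subst (_ ⊆_) (values-transport π) (LeftOf⇒⊆values (transport π) l))))
      (λ l → ⊆values⇒LeftOf (transport π) (subst (_ ⊆_) (sym (values-transport π))
        (to-consecutive⁺ (values π) d (inj₁ e) (LeftOf⇒⊆values π l))))

  transport-cancel : ∀ {n} (π : Word n) → Avoider π → decode n (from (values (transport π))) ≡ π
  transport-cancel {n} π (perm , avoids) = begin
    decode n (from (values (transport π)))
      ≡⟨ cong (decode n ∘ from) (values-transport π) ⟩
    decode n (from (to (values π)))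
      ≡⟨ cong (decode n) (from∘to (values π) (IsPerm⇒Distinct π perm) (Avoids⇒Free repσ π avoids)) ⟩
    decode n (values π)
      ≡⟨ decode-values π ⟩
    π ∎
    where open ≡-Reasoning

  WithCharge : ∀ n → ℕ → Vec (Fin 3) 3 → List (Word n)
  WithCharge n k ρ = filter (λ π → ch π ≟ k) (Av n ρ)

  WithCharge⁻ : ∀ {n k π} → π ∈ WithCharge n k σ → Avoider π × ch π ≡ k
  WithCharge⁻ {n} {k} p = (proj₂ perm , proj₂ avoids) , proj₂ level
    where
    level = ∈-filter⁻ (λ π → ch π ≟ k) {xs = Av n σ} p
    avoids = ∈-filter⁻ (λ π → avoids? π σ) {xs = S n} (proj₁ level)
    perm = ∈-filter⁻ isPerm? {xs = words n} (proj₁ avoids)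

  WithCharge⁺ : ∀ {n k π} → IsPerm π → Avoids π τ → ch π ≡ k → π ∈ WithCharge n k τ
  WithCharge⁺ {k = k} {π} perm avoids e =
    ∈-filter⁺ (λ π → ch π ≟ k) (∈-filter⁺ (λ π → avoids? π τ) (IsPerm⇒∈S π perm) avoids) e

  ChCoeff-≤ : ∀ n k → ChCoeff n σ k ≤ ChCoeff n τ k
  ChCoeff-≤ n k =
    length-≤-injection (WithCharge n k σ) (WithCharge n k τ) transport unique into injective
    where
    unique : Unique (WithCharge n k σ)
    unique = Unique.filter⁺ (λ π → ch π ≟ k)
      (Unique.filter⁺ (λ π → avoids? π σ) (Unique.filter⁺ isPerm? (words-unique n)))
    into : ∀ {π} → π ∈ WithCharge n k σ → transport π ∈ WithCharge n k τ
    into {π} p = WithCharge⁺ (transport-perm π avoider) (transport-avoids π avoider)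
      (trans (ch-transport π avoider) (proj₂ (WithCharge⁻ p)))
      where avoider = proj₁ (WithCharge⁻ p)
    injective : ∀ {π ρ} → π ∈ WithCharge n k σ → ρ ∈ WithCharge n k σ →
      transport π ≡ transport ρ → π ≡ ρ
    injective {π} {ρ} p q e = begin
      π                                      ≡⟨ sym (transport-cancel π (proj₁ (WithCharge⁻ p))) ⟩
      decode n (from (values (transport π))) ≡⟨ cong (decode n ∘ from ∘ values) e ⟩
      decode n (from (values (transport ρ))) ≡⟨ transport-cancel ρ (proj₁ (WithCharge⁻ q)) ⟩
      ρ                                      ∎
      where open ≡-Reasoning

ChWilfEquiv-from-injections : ∀ {σ τ P P′} → Represents σ P → Represents τ P′ →
  ConsecutiveOrderInjection P P′ → ConsecutiveOrderInjection P′ P → ChWilfEquiv σ τ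
ChWilfEquiv-from-injections repσ repτ ι ι′ n k =
  ≤-antisym (Transport.ChCoeff-≤ repσ repτ ι n k) (Transport.ChCoeff-≤ repτ repσ ι′ n k)

-- The four classes

ChWilfEquiv-312-132 : ChWilfEquiv p312 p132
ChWilfEquiv-312-132 = ChWilfEquiv-from-injections represents-312 represents-132
  (reverse-injection (flipBlocks-injection false)) (reverse-injection (flipBlocks-injection true))

ChWilfEquiv-213-231 : ChWilfEquiv p213 p231
ChWilfEquiv-213-231 = ChWilfEquiv-from-injections represents-213 represents-231
  (flipBlocks-injection false) (flipBlocks-injection true)

SameClass⇒ChWilfEquiv : ∀ {σ τ} → SameClass σ τ → ChWilfEquiv σ τ
SameClass⇒ChWilfEquiv (inj₁ (refl , refl)) n k = refl
SameClass⇒ChWilfEquiv (inj₂ (inj₁ (refl , refl))) n k = refl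
SameClass⇒ChWilfEquiv (inj₂ (inj₂ (inj₁ (inj₁ refl , inj₁ refl)))) n k = refl
SameClass⇒ChWilfEquiv (inj₂ (inj₂ (inj₁ (inj₁ refl , inj₂ refl)))) = ChWilfEquiv-312-132
SameClass⇒ChWilfEquiv (inj₂ (inj₂ (inj₁ (inj₂ refl , inj₁ refl)))) n k = sym (ChWilfEquiv-312-132 n k)
SameClass⇒ChWilfEquiv (inj₂ (inj₂ (inj₁ (inj₂ refl , inj₂ refl)))) n k = refl
SameClass⇒ChWilfEquiv (inj₂ (inj₂ (inj₂ (inj₁ refl , inj₁ refl)))) n k = refl
SameClass⇒ChWilfEquiv (inj₂ (inj₂ (inj₂ (inj₁ refl , inj₂ refl)))) = ChWilfEquiv-213-231
SameClass⇒ChWilfEquiv (inj₂ (inj₂ (inj₂ (inj₂ refl , inj₁ refl)))) n k = sym (ChWilfEquiv-213-231 n k)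
SameClass⇒ChWilfEquiv (inj₂ (inj₂ (inj₂ (inj₂ refl , inj₂ refl)))) n k = refl

sameClass? : ∀ σ τ → Dec (SameClass σ τ)
sameClass? σ τ =
        ((σ ≟ᵥ p123) ×-dec (τ ≟ᵥ p123))
  ⊎-dec ((σ ≟ᵥ p321) ×-dec (τ ≟ᵥ p321))
  ⊎-dec (((σ ≟ᵥ p312) ⊎-dec (σ ≟ᵥ p132)) ×-dec ((τ ≟ᵥ p312) ⊎-dec (τ ≟ᵥ p132)))
  ⊎-dec (((σ ≟ᵥ p213) ⊎-dec (σ ≟ᵥ p231)) ×-dec ((τ ≟ᵥ p213) ⊎-dec (τ ≟ᵥ p231)))
  where _≟ᵥ_ = Vec.≡-dec _≟ᶠ_

-- The coefficients of Ch₃(σ; q); the charge of a permutation of [3] is at most 3.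
Ch₃ : Vec (Fin 3) 3 → List ℕ
Ch₃ σ = map (ChCoeff 3 σ) (upTo 4)

Ch₃-separates : All (λ σ → All (λ τ → Ch₃ σ ≡ Ch₃ τ → SameClass σ τ) (S 3)) (S 3)
Ch₃-separates =
  toWitness {a? = all? (λ σ → all? (λ τ → ≡-dec _≟_ (Ch₃ σ) (Ch₃ τ) →-dec sameClass? σ τ) (S 3)) (S 3)} _

ChWilfEquiv⇒Ch₃≡ : ∀ {σ τ} → ChWilfEquiv σ τ → Ch₃ σ ≡ Ch₃ τ
ChWilfEquiv⇒Ch₃≡ {σ} {τ} e = map-cong {f = ChCoeff 3 σ} {g = ChCoeff 3 τ} (e 3) (upTo 4)

-- The predicates are given explicitly: inferring them would make Agda unfold `ChCoeff`.
Ch₃≡⇒SameClass : ∀ σ τ → IsPerm σ → IsPerm τ → Ch₃ σ ≡ Ch₃ τ → SameClass σ τ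
Ch₃≡⇒SameClass σ τ σ-perm τ-perm =
  All.lookup {P = λ τ → Ch₃ σ ≡ Ch₃ τ → SameClass σ τ}
    (All.lookup {P = λ σ → All (λ τ → Ch₃ σ ≡ Ch₃ τ → SameClass σ τ) (S 3)}
      Ch₃-separates (IsPerm⇒∈S σ σ-perm))
    (IsPerm⇒∈S τ τ-perm)

theorem1 : (σ τ : Vec (Fin 3) 3) → IsPerm σ → IsPerm τ →
    (ChWilfEquiv σ τ ⇔ SameClass σ τ)
theorem1 σ τ σ-perm τ-perm =
  mk⇔ (Ch₃≡⇒SameClass σ τ σ-perm τ-perm ∘ ChWilfEquiv⇒Ch₃≡ {σ} {τ}) (SameClass⇒ChWilfEquiv {σ} {τ})
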